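{- Let $\Gamma$ be a $4$-regular infinite planar tessellation with non-negative combinatorial curvature, and let $\sigma_1\ne\sigma_2$ be faces of $\Gamma$ of degrees $k_1,k_2\ge 8$. If there is a square $Q$ lower-adjacent to both $\sigma_1$ and $\sigma_2$, then there exist two triangles $\tau$ and $\omega$ such that $\tau$ is $\sigma_1$-adjacent to $Q$, $\omega$ is $\sigma_2$-adjacent to $Q$, and $\partial\tau\setminus\partial\sigma_1=\partial\omega\setminus\partial\sigma_2$.
   Context: A planar tessellation is a locally finite, connected, simple graph embedded in $\mathbb S^2$ or $\mathbb R^2$, with faces the components of the complement, such that: (i) every closed face is a closed disk bounded by finitely many edges; (ii) every edge lies in exactly two different closed faces; (iii) two distinct closed faces intersect in the empty set, a single vertex, or the closure of a single edge; all vertex and face degrees (face degree = number of boundary edges) are at least $3$. Infinite means embedded in $\mathbb R^2$. The combinatorial curvature at a vertex $x$ is $\Phi(x)=1-\frac{|x|}{2}+\sum_{\sigma}\frac{1}{|\sigma|}$, summed over faces whose closure contains $x$; non-negative curvature means $\Phi\ge0$ at every vertex. $4$-regular means all vertices have degree $4$. $\partial\sigma$ is the set of vertices in the closure of the face $\sigma$. Two faces are lower-adjacent if their closures contain a common edge. For a face $\sigma$, faces $\tau,\omega$ are $\sigma$-adjacent if both are lower-adjacent to $\sigma$ and $\bar\tau\cap\bar\omega$ is a single vertex lying on $\sigma$. -}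

module Defs where

open import Data.Nat using (ℕ; zero; suc; _+_; _≤_; pred; NonZero)
open import Data.Nat.DivMod using (_mod_)
open import Data.Fin using (Fin; toℕ)
open import Data.List using (List; []; _∷_; _++_)
open import Data.List.Membership.Propositional using (_∉_)
open import Data.Product using (Σ; ∃; _×_; _,_)
open import Data.Sum using (_⊎_)
open import Data.Empty using (⊥)
open import Data.Integer using (+_)
open import Data.Rational.Unnormalised using (ℚᵘ; mkℚᵘ; 0ℚᵘ; 1ℚᵘ) renaming (_+_ to _+q_; _-_ to _-q_; _≤_ to _≤q_)
open import Relation.Binary.PropositionalEquality using (_≡_; _≢_)
open import Relation.Binary.Construct.Closure.Equivalence using (EqClosure)
open import Function.Definitions using (Injective)

csuc : ∀ {n} → Fin n → Fin n
csuc {suc m} i = suc (toℕ i) mod suc m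

cpred : ∀ {n} → Fin n → Fin n
cpred {suc m} i = (toℕ i + m) mod suc m

sumFin : ∀ n → (Fin n → ℚᵘ) → ℚᵘ
sumFin zero    f = 0ℚᵘ
sumFin (suc n) f = f Fin.zero +q sumFin n (λ i → f (Fin.suc i))

-- 1/k as an unnormalised rational (used only for k ≥ 3)
recip : ℕ → ℚᵘ
recip k = mkℚᵘ (+ 1) (pred k)

-- V, F      : vertices and faces
--   fdeg σ    : degree of face σ;  bd σ : Fin (fdeg σ) → V  its boundary
--               vertices listed in cyclic order (boundary cycle)
--   vdeg x    : degree of vertex x; nb x : neighbours of x in cyclic
--               (rotation) order around x;  cor x i : the face lying in the
--               corner at x between the edges x–nb x i and x–nb x (i+1).

record PreTess : Set₁ where
  field
    V F  : Set
    fdeg : F → ℕ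
    bd   : (σ : F) → Fin (fdeg σ) → V
    vdeg : V → ℕ
    nb   : (x : V) → Fin (vdeg x) → V
    cor  : (x : V) → Fin (vdeg x) → F

module _ (T : PreTess) where
  open PreTess T

  Adj : V → V → Set
  Adj x y = ∃ λ i → nb x i ≡ y

  _∈∂_ : V → F → Set
  x ∈∂ σ = ∃ λ j → bd σ j ≡ x

  EdgeOf : F → V → V → Set
  EdgeOf σ x y = ∃ λ j → (bd σ j ≡ x × bd σ (csuc j) ≡ y)
                       ⊎ (bd σ j ≡ y × bd σ (csuc j) ≡ x)

  -- walk from x to y through the listed intermediate/final vertices
  Walk : V → V → List V → Set
  Walk x y []      = x ≡ y
  Walk x y (z ∷ r) = Adj x z × Walk z y r

  -- boundary loop of σ starting (and ending) at bd σ j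
  loopGo : (σ : F) → ℕ → Fin (fdeg σ) → List V
  loopGo σ zero    i = bd σ i ∷ []
  loopGo σ (suc k) i = bd σ i ∷ loopGo σ k (csuc i)

  faceLoop : (σ : F) → Fin (fdeg σ) → List V
  faceLoop σ j = loopGo σ (fdeg σ) j

  data HStep : List V → List V → Set where
    backtrack : ∀ p q a b → Adj a b → HStep (p ++ a ∷ b ∷ a ∷ q) (p ++ a ∷ q)
    faceIns   : ∀ p q σ j → HStep (p ++ bd σ j ∷ q) (p ++ faceLoop σ j ++ q)

  record IsInfinitePlanarTessellation : Set where
    field
      vdeg≥3   : ∀ x → 3 ≤ vdeg x
      nb-inj   : ∀ x → Injective _≡_ _≡_ (nb x)
      nb-loop  : ∀ x i → nb x i ≢ x
      adj-sym  : ∀ x y → Adj x y → Adj y x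
      fdeg≥3   : ∀ σ → 3 ≤ fdeg σ
      bd-inj   : ∀ σ → Injective _≡_ _≡_ (bd σ)
      bd-adj   : ∀ σ j → Adj (bd σ j) (bd σ (csuc j))
      -- faces around each vertex form a single cycle (surface condition);
      -- this gives (ii): every edge lies in exactly two distinct faces
      cor-inj  : ∀ x → Injective _≡_ _≡_ (cor x)
      cor-bd   : ∀ x i → ∃ λ j → bd (cor x i) j ≡ x ×
                   ((bd (cor x i) (cpred j) ≡ nb x i × bd (cor x i) (csuc j) ≡ nb x (csuc i))
                   ⊎ (bd (cor x i) (csuc j) ≡ nb x i × bd (cor x i) (cpred j) ≡ nb x (csuc i)))
      cor-all  : ∀ σ x → x ∈∂ σ → ∃ λ i → cor x i ≡ σ
      -- (iii) two distinct closed faces meet in ∅, a vertex, or a closed edge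
      meet-edge : ∀ σ τ → σ ≢ τ → ∀ x y → x ≢ y → x ∈∂ σ → x ∈∂ τ → y ∈∂ σ → y ∈∂ τ →
                    EdgeOf σ x y × EdgeOf τ x y
      meet-two  : ∀ σ τ → σ ≢ τ → ∀ x y z → x ≢ y → y ≢ z → x ≢ z →
                    x ∈∂ σ → x ∈∂ τ → y ∈∂ σ → y ∈∂ τ → z ∈∂ σ → z ∈∂ τ → ⊥
      connected : ∀ x y → ∃ λ r → Walk x y r
      -- simply connected 2-complex (with the above: a surface ≅ S² or ℝ²)
      simplyConnected : ∀ x r → Walk x x r → EqClosure HStep (x ∷ r) (x ∷ [])
      -- infinite (hence ℝ², not S²)
      infinite : ∀ (l : List V) → ∃ λ v → v ∉ l

  FourRegular : Set
  FourRegular = ∀ x → vdeg x ≡ 4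

  curvature : V → ℚᵘ
  curvature x = (1ℚᵘ -q mkℚᵘ (+ vdeg x) 1) +q sumFin (vdeg x) (λ i → recip (fdeg (cor x i)))

  NonNegCurvature : Set
  NonNegCurvature = ∀ x → 0ℚᵘ ≤q curvature x

  LowerAdj : F → F → Set
  LowerAdj σ τ = ∃ λ x → ∃ λ y → EdgeOf σ x y × EdgeOf τ x y

  SigmaAdj : F → F → F → Set
  SigmaAdj σ τ ω = LowerAdj τ σ × LowerAdj ω σ ×
    (∃ λ v → v ∈∂ τ × v ∈∂ ω × v ∈∂ σ × (∀ u → u ∈∂ τ → u ∈∂ ω → u ≡ v))

{-# OPTIONS --safe #-}
-- At a 4-valent vertex Φ ≥ 0 says that the reciprocals of the four face degrees sum to at
-- least 1; as 1/8 + 1/4 + 1/4 + 1/3 < 1, no vertex has faces of degrees ≥ 8, ≥ 4, ≥ 4 in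
-- three of its corners. Hence no vertex lies on σ₁, σ₂ and Q, so σ₁ and σ₂ contain opposite
-- sides ab and dc of the square Q = abcd, and the two faces at a other than σ₁ and Q are
-- triangles: S = ade across ad, and τ = aea′ next to σ₁. The same holds at d, and since the
-- edge ad lies in only two faces the triangle across it is S again, so τ ∖ ∂σ₁ and ω ∖ ∂σ₂
-- are both the apex {e} of S.
module Submission where

open import Defs
open import Data.Nat using (_≤_)
open import Data.Product using (Σ; ∃; _×_; _,_)
open import Relation.Nullary using (¬_)
open import Relation.Binary.PropositionalEquality using (_≡_; _≢_)
open import Function.Bundles using (_⇔_)

open import Data.Bool using (if_then_else_; _∨_)
open import Data.Empty using (⊥; ⊥-elim)
open import Data.Fin using (Fin; toℕ; opposite; _≟_)
open import Data.Fin.Patterns using (0F; 1F; 2F; 3F)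
open import Data.Fin.Properties
  using (toℕ-fromℕ<; toℕ-injective; toℕ<n; all?; opposite-involutive)
import Data.Integer as ℤ
import Data.Integer.Properties as ℤ
open import Data.Nat as ℕ using (ℕ; suc; _+_; _%_; _≤?_)
open import Data.Nat.DivMod using (%-distribˡ-+; m%n%n≡m%n; [m+n]%n≡m%n; m<n⇒m%n≡m)
import Data.Nat.Properties as ℕ
open import Data.Rational.Unnormalised using (ℚᵘ; mkℚᵘ; 0ℚᵘ; 1ℚᵘ; *≤*)
  renaming (_+_ to _+q_; _-_ to _-q_; _≤_ to _≤q_)
import Data.Rational.Unnormalised.Properties as ℚ
open import Data.Sum as Sum using (_⊎_; inj₁; inj₂)
open import Function using (_∘_)
open import Function.Bundles using (mk⇔)
open import Function.Properties.Equivalence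
  using () renaming (sym to ⇔-sym; trans to ⇔-trans)
open import Relation.Nullary using (does; yes; no)
open import Relation.Nullary.Decidable using (from-yes; from-no; ¬?; _→-dec_; _⊎-dec_)
open import Relation.Binary.PropositionalEquality
  using (refl; sym; trans; cong; subst; subst₂; ≢-sym; module ≡-Reasoning)

[m%n+o]%n≡[m+o]%n : ∀ m o n .{{_ : ℕ.NonZero n}} → (m % n + o) % n ≡ (m + o) % n
[m%n+o]%n≡[m+o]%n m o n = begin
  (m % n + o) % n          ≡⟨ %-distribˡ-+ (m % n) o n ⟩
  (m % n % n + o % n) % n  ≡⟨ cong (λ k → (k + o % n) % n) (m%n%n≡m%n m n) ⟩
  (m % n + o % n) % n      ≡⟨ %-distribˡ-+ m o n ⟨
  (m + o) % n              ∎
  where open ≡-Reasoning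

toℕ-csuc : ∀ {m} (i : Fin (suc m)) → toℕ (csuc i) ≡ suc (toℕ i) % suc m
toℕ-csuc i = toℕ-fromℕ< _

toℕ-cpred : ∀ {m} (i : Fin (suc m)) → toℕ (cpred i) ≡ (toℕ i + m) % suc m
toℕ-cpred i = toℕ-fromℕ< _

csuc-cpred : ∀ {n} (i : Fin n) → csuc (cpred i) ≡ i
csuc-cpred {suc m} i = toℕ-injective (begin
  toℕ (csuc (cpred i))               ≡⟨ toℕ-csuc (cpred i) ⟩
  suc (toℕ (cpred i)) % suc m        ≡⟨ cong (λ k → suc k % suc m) (toℕ-cpred i) ⟩
  suc ((toℕ i + m) % suc m) % suc m  ≡⟨ cong (_% suc m) (ℕ.+-comm 1 _) ⟩
  ((toℕ i + m) % suc m + 1) % suc m  ≡⟨ [m%n+o]%n≡[m+o]%n (toℕ i + m) 1 (suc m) ⟩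
  (toℕ i + m + 1) % suc m            ≡⟨ cong (_% suc m) (ℕ.+-assoc (toℕ i) m 1) ⟩
  (toℕ i + (m + 1)) % suc m          ≡⟨ cong (λ k → (toℕ i + k) % suc m) (ℕ.+-comm m 1) ⟩
  (toℕ i + suc m) % suc m            ≡⟨ [m+n]%n≡m%n (toℕ i) (suc m) ⟩
  toℕ i % suc m                      ≡⟨ m<n⇒m%n≡m (toℕ<n i) ⟩
  toℕ i                              ∎)
  where open ≡-Reasoning

cpred-csuc : ∀ {n} (i : Fin n) → cpred (csuc i) ≡ i
cpred-csuc {suc m} i = toℕ-injective (begin
  toℕ (cpred (csuc i))               ≡⟨ toℕ-cpred (csuc i) ⟩
  (toℕ (csuc i) + m) % suc m         ≡⟨ cong (λ k → (k + m) % suc m) (toℕ-csuc i) ⟩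
  (suc (toℕ i) % suc m + m) % suc m  ≡⟨ [m%n+o]%n≡[m+o]%n (suc (toℕ i)) m (suc m) ⟩
  (suc (toℕ i) + m) % suc m          ≡⟨ cong (_% suc m) (ℕ.+-suc (toℕ i) m) ⟨
  (toℕ i + suc m) % suc m            ≡⟨ [m+n]%n≡m%n (toℕ i) (suc m) ⟩
  toℕ i % suc m                      ≡⟨ m<n⇒m%n≡m (toℕ<n i) ⟩
  toℕ i                              ∎)
  where open ≡-Reasoning

csuc-injective : ∀ {n} {i j : Fin n} → csuc i ≡ csuc j → i ≡ j
csuc-injective {i = i} {j} eq = trans (sym (cpred-csuc i)) (trans (cong cpred eq) (cpred-csuc j))

opposite-injective : ∀ {n} {i j : Fin n} → opposite i ≡ opposite j → i ≡ j
opposite-injective {i = i} {j} eq =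
  trans (sym (opposite-involutive i)) (trans (cong opposite eq) (opposite-involutive j))

opposite-sides-of-4-cycle : ∀ {n} → n ≡ 4 → (j k : Fin n) →
  j ≢ k → csuc j ≢ k → j ≢ csuc k → csuc (csuc j) ≡ k
opposite-sides-of-4-cycle refl = from-yes (all? λ (j : Fin 4) → all? λ k →
  ¬? (j ≟ k) →-dec ¬? (csuc j ≟ k) →-dec ¬? (j ≟ csuc k) →-dec csuc (csuc j) ≟ k)

three-distinct-exhaust : ∀ {n} → n ≡ 3 → (i j k l : Fin n) →
  i ≢ j → i ≢ k → j ≢ k → l ≡ i ⊎ l ≡ j ⊎ l ≡ k
three-distinct-exhaust refl = from-yes (all? λ (i : Fin 3) → all? λ j → all? λ k → all? λ l →
  ¬? (i ≟ j) →-dec ¬? (i ≟ k) →-dec ¬? (j ≟ k) →-dec (l ≟ i ⊎-dec l ≟ j ⊎-dec l ≟ k))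

pigeonhole : ∀ {A : Set} {a b c u v : A} →
  a ≡ u ⊎ a ≡ v → b ≡ u ⊎ b ≡ v → c ≡ u ⊎ c ≡ v → a ≡ b ⊎ a ≡ c ⊎ b ≡ c
pigeonhole (inj₁ a≡u) (inj₁ b≡u) _          = inj₁ (trans a≡u (sym b≡u))
pigeonhole (inj₂ a≡v) (inj₂ b≡v) _          = inj₁ (trans a≡v (sym b≡v))
pigeonhole (inj₁ a≡u) (inj₂ _)   (inj₁ c≡u) = inj₂ (inj₁ (trans a≡u (sym c≡u)))
pigeonhole (inj₂ a≡v) (inj₁ _)   (inj₂ c≡v) = inj₂ (inj₁ (trans a≡v (sym c≡v)))
pigeonhole (inj₁ _)   (inj₂ b≡v) (inj₂ c≡v) = inj₂ (inj₂ (trans b≡v (sym c≡v)))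
pigeonhole (inj₂ _)   (inj₁ b≡u) (inj₁ c≡u) = inj₂ (inj₂ (trans b≡u (sym c≡u)))

recip-antitone : ∀ {m n} → m ≤ n → recip n ≤q recip m
recip-antitone m≤n = *≤* (subst₂ ℤ._≤_ (sym (ℤ.*-identityˡ _)) (sym (ℤ.*-identityˡ _))
  (ℤ.+≤+ (ℕ.s≤s (ℕ.pred-mono-≤ m≤n))))

sumFin-mono : ∀ n {f g : Fin n → ℚᵘ} → (∀ i → f i ≤q g i) → sumFin n f ≤q sumFin n g
sumFin-mono ℕ.zero  f≤g = ℚ.≤-refl
sumFin-mono (suc n) f≤g = ℚ.+-mono-≤ (f≤g 0F) (sumFin-mono n (f≤g ∘ Fin.suc))

-- curvature T x unfolds to vertexCurvature (vdeg x) (fdeg ∘ cor x).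
vertexCurvature : ∀ n → (Fin n → ℕ) → ℚᵘ
vertexCurvature n deg = (1ℚᵘ -q mkℚᵘ (ℤ.+ n) 1) +q sumFin n (recip ∘ deg)

cornerBound : (p q j : Fin 4) → Fin 4 → ℕ
cornerBound p q j i = if does (i ≟ p) then 8 else if does (i ≟ q) ∨ does (i ≟ j) then 4 else 3

cornerBound≤ : ∀ {p q j} (deg : Fin 4 → ℕ) → (∀ i → 3 ≤ deg i) →
  8 ≤ deg p → 4 ≤ deg q → 4 ≤ deg j → ∀ i → cornerBound p q j i ≤ deg i
cornerBound≤ {p} {q} {j} deg 3≤deg 8≤p 4≤q 4≤j i with i ≟ p | i ≟ q | i ≟ j
... | yes refl | _        | _        = 8≤p
... | no _     | yes refl | _        = 4≤q
... | no _     | no _     | yes refl = 4≤j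
... | no _     | no _     | no _     = 3≤deg i

cornerBound-curvature<0 : ∀ p q j → p ≢ q → p ≢ j → q ≢ j →
  ¬ 0ℚᵘ ≤q vertexCurvature 4 (cornerBound p q j)
cornerBound-curvature<0 = from-yes (all? λ p → all? λ q → all? λ j →
  ¬? (p ≟ q) →-dec ¬? (p ≟ j) →-dec ¬? (q ≟ j) →-dec
  ¬? (0ℚᵘ ℚ.≤? vertexCurvature 4 (cornerBound p q j)))

large-corners-curvature<0 : ∀ {p q j} (deg : Fin 4 → ℕ) → (∀ i → 3 ≤ deg i) →
  p ≢ q → p ≢ j → q ≢ j → 8 ≤ deg p → 4 ≤ deg q → 4 ≤ deg j →
  ¬ 0ℚᵘ ≤q vertexCurvature 4 deg
large-corners-curvature<0 {p} {q} {j} deg 3≤deg p≢q p≢j q≢j 8≤p 4≤q 4≤j Φ≥0 =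
  cornerBound-curvature<0 p q j p≢q p≢j q≢j
    (ℚ.≤-trans Φ≥0 (ℚ.+-monoʳ-≤ (1ℚᵘ -q mkℚᵘ (ℤ.+ 4) 1)
      (sumFin-mono 4 (recip-antitone ∘ cornerBound≤ deg 3≤deg 8≤p 4≤q 4≤j))))

module Tessellation (T : PreTess) where
  open PreTess T

  infix 4 _∈_
  _∈_ : V → F → Set
  _∈_ = _∈∂_ T

  Edge : F → V → V → Set
  Edge = EdgeOf T

  -- The shape of cor-bd: x lies on ∂σ between its boundary neighbours u and w.
  Corner : F → V → V → V → Set
  Corner σ x u w = ∃ λ j → bd σ j ≡ x ×
    ((bd σ (cpred j) ≡ u × bd σ (csuc j) ≡ w) ⊎ (bd σ (csuc j) ≡ u × bd σ (cpred j) ≡ w))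

  module _ {σ : F} where

    edge-sym : ∀ {x y} → Edge σ x y → Edge σ y x
    edge-sym (j , inj₁ xy) = j , inj₂ xy
    edge-sym (j , inj₂ yx) = j , inj₁ yx

    edge-source : ∀ {x y} → Edge σ x y → x ∈ σ
    edge-source (j , inj₁ (x≡ , _)) = j , x≡
    edge-source (j , inj₂ (_ , x≡)) = csuc j , x≡

    edge-target : ∀ {x y} → Edge σ x y → y ∈ σ
    edge-target = edge-source ∘ edge-sym

    corner-swap : ∀ {x u w} → Corner σ x u w → Corner σ x w u
    corner-swap (j , x≡ , inj₁ (u≡ , w≡)) = j , x≡ , inj₂ (w≡ , u≡)
    corner-swap (j , x≡ , inj₂ (u≡ , w≡)) = j , x≡ , inj₁ (w≡ , u≡)

    corner-left-edge : ∀ {x u w} → Corner σ x u w → Edge σ x u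
    corner-left-edge (j , x≡ , inj₁ (u≡ , _)) =
      cpred j , inj₂ (u≡ , trans (cong (bd σ) (csuc-cpred j)) x≡)
    corner-left-edge (j , x≡ , inj₂ (u≡ , _)) = j , inj₁ (x≡ , u≡)

    corner-right-edge : ∀ {x u w} → Corner σ x u w → Edge σ x w
    corner-right-edge = corner-left-edge ∘ corner-swap

    corner-centre : ∀ {x u w} → Corner σ x u w → x ∈ σ
    corner-centre = edge-source ∘ corner-left-edge

    corner-left : ∀ {x u w} → Corner σ x u w → u ∈ σ
    corner-left = edge-target ∘ corner-left-edge

    corner-right : ∀ {x u w} → Corner σ x u w → w ∈ σ
    corner-right = edge-target ∘ corner-right-edge

  boundary-edge : ∀ {Q σ} → LowerAdj T Q σ → ∃ λ j → Edge σ (bd Q j) (bd Q (csuc j))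
  boundary-edge (_ , _ , (j , inj₁ (refl , refl)) , e) = j , e
  boundary-edge (_ , _ , (j , inj₂ (refl , refl)) , e) = j , edge-sym e

  large≢square : ∀ {P Q} → 8 ≤ fdeg P → fdeg Q ≡ 4 → P ≢ Q
  large≢square P-large Q-square refl = from-no (8 ≤? 4) (subst (8 ≤_) Q-square P-large)

  triangle≢square : ∀ {S Q} → fdeg S ≡ 3 → fdeg Q ≡ 4 → S ≢ Q
  triangle≢square S-triangle Q-square refl with trans (sym S-triangle) Q-square
  ... | ()

  triangle≢large : ∀ {S P} → fdeg S ≡ 3 → 8 ≤ fdeg P → S ≢ P
  triangle≢large S-triangle P-large refl = from-no (8 ≤? 3) (subst (8 ≤_) S-triangle P-large)

  -- no-large-triple is the consequence of Φ(x) ≥ 0 that is used, in a form that survives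
  -- reindexing the corners.
  record Wheel (x : V) : Set where
    field
      face            : Fin 4 → F
      spoke           : Fin 4 → V
      spoke-injective : ∀ {i j} → spoke i ≡ spoke j → i ≡ j
      spoke≢centre    : ∀ i → spoke i ≢ x
      corner          : ∀ i → Corner (face i) x (spoke i) (spoke (csuc i))
      covers          : ∀ {σ} → x ∈ σ → ∃ λ i → face i ≡ σ
      no-large-triple : ∀ {p q j} → p ≢ q → p ≢ j → q ≢ j →
                        8 ≤ fdeg (face p) → 4 ≤ fdeg (face q) → 4 ≤ fdeg (face j) → ⊥

    spoke≢ : ∀ {i j} → i ≢ j → spoke i ≢ spoke j
    spoke≢ i≢j = i≢j ∘ spoke-injective

    centre≢spoke : ∀ i → x ≢ spoke i
    centre≢spoke = ≢-sym ∘ spoke≢centre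

  open Wheel using (face; spoke)

  module _ {x : V} (W : Wheel x) where
    open Wheel W hiding (face; spoke)

    reindex : (r s : Fin 4 → Fin 4) → (∀ {i j} → r i ≡ r j → i ≡ j) → (r⁻¹ : Fin 4 → Fin 4) →
      (∀ i → r (r⁻¹ i) ≡ i) → (∀ {i j} → s i ≡ s j → i ≡ j) →
      (∀ i → Corner (face W (r i)) x (spoke W (s i)) (spoke W (s (csuc i)))) → Wheel x
    reindex r s r-injective r⁻¹ r∘r⁻¹ s-injective corner′ = record
      { face            = face W ∘ r
      ; spoke           = spoke W ∘ s
      ; spoke-injective = s-injective ∘ spoke-injective
      ; spoke≢centre    = spoke≢centre ∘ s
      ; corner          = corner′
      ; covers          = λ x∈σ → let i , i≡ = covers x∈σ in
                                    r⁻¹ i , trans (cong (face W) (r∘r⁻¹ i)) i≡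
      ; no-large-triple = λ p≢q p≢j q≢j →
          no-large-triple (p≢q ∘ r-injective) (p≢j ∘ r-injective) (q≢j ∘ r-injective)
      }

    rotate : Wheel x
    rotate = reindex csuc csuc csuc-injective cpred csuc-cpred csuc-injective (corner ∘ csuc)

    reflect : Wheel x
    reflect = reindex opposite (csuc ∘ opposite) opposite-injective opposite opposite-involutive
      (opposite-injective ∘ csuc-injective) reflected-corner
      where
      reflected-corner : ∀ i → Corner (face W (opposite i)) x
        (spoke W (csuc (opposite i))) (spoke W (csuc (opposite (csuc i))))
      reflected-corner 0F = corner-swap (corner 3F)
      reflected-corner 1F = corner-swap (corner 2F)
      reflected-corner 2F = corner-swap (corner 1F)
      reflected-corner 3F = corner-swap (corner 0F)

  Aligned : ∀ {x} → Wheel x → F → F → V → Set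
  Aligned W P Q y = face W 0F ≡ P × face W 1F ≡ Q × spoke W 1F ≡ y

  rotate-to : ∀ {x} (W : Wheel x) p →
    Σ (Wheel x) λ W′ → Aligned W′ (face W p) (face W (csuc p)) (spoke W (csuc p))
  rotate-to W 0F = W , refl , refl , refl
  rotate-to W 1F = rotate W , refl , refl , refl
  rotate-to W 2F = rotate (rotate W) , refl , refl , refl
  rotate-to W 3F = rotate (rotate (rotate W)) , refl , refl , refl

  reflect-to : ∀ {x} (W : Wheel x) q →
    Σ (Wheel x) λ W′ → Aligned W′ (face W (csuc q)) (face W q) (spoke W (csuc q))
  reflect-to W 0F = rotate-to (reflect W) 2F
  reflect-to W 1F = rotate-to (reflect W) 1F
  reflect-to W 2F = rotate-to (reflect W) 0F
  reflect-to W 3F = rotate-to (reflect W) 3F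

  record OppositeSides (Q σ₁ σ₂ : F) : Set where
    field
      a b c d : V
      σ₁-ab   : Edge σ₁ a b
      σ₂-dc   : Edge σ₂ d c
      Q-ab    : Edge Q a b
      Q-ad    : Edge Q a d
      Q-dc    : Edge Q d c
      b≢d     : b ≢ d
      c≢a     : c ≢ a

  -- Around x the faces are P, Q, S, τ in this cyclic order: S is the triangle x z apex
  -- on the far side of the edge x z of Q, and τ is the triangle between S and P.
  record CornerTriangles (x : V) (P Q : F) (z : V) : Set where
    field
      S τ          : F
      apex         : V
      S-triangle   : fdeg S ≡ 3
      τ-triangle   : fdeg τ ≡ 3
      S-xz         : Edge S x z
      apex∈S       : apex ∈ S
      S-vertices   : ∀ {t} → t ∈ S → t ≡ x ⊎ t ≡ z ⊎ t ≡ apex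
      apex≢x       : apex ≢ x
      apex≢z       : apex ≢ z
      τ-σ-adjacent : SigmaAdj T P τ Q
      τ-outside-P  : ∀ v → (v ∈ τ × ¬ v ∈ P) ⇔ v ≡ apex

  module Planar (ax : IsInfinitePlanarTessellation T) where
    open IsInfinitePlanarTessellation ax

    edge-from : ∀ {σ j y} → Edge σ (bd σ j) y → y ≡ bd σ (csuc j) ⊎ y ≡ bd σ (cpred j)
    edge-from {σ} (k , inj₁ (k≡j , y≡)) with bd-inj σ k≡j
    ... | refl = inj₁ (sym y≡)
    edge-from {σ} (k , inj₂ (y≡ , k+1≡j)) with bd-inj σ k+1≡j
    ... | refl = inj₂ (trans (sym y≡) (cong (bd σ) (sym (cpred-csuc k))))

    corner-neighbours : ∀ {σ x u w y} → Corner σ x u w → Edge σ x y → y ≡ u ⊎ y ≡ w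
    corner-neighbours (j , refl , inj₁ (u≡ , w≡)) x-y with edge-from x-y
    ... | inj₁ y≡ = inj₂ (trans y≡ w≡)
    ... | inj₂ y≡ = inj₁ (trans y≡ u≡)
    corner-neighbours (j , refl , inj₂ (u≡ , w≡)) x-y with edge-from x-y
    ... | inj₁ y≡ = inj₁ (trans y≡ u≡)
    ... | inj₂ y≡ = inj₂ (trans y≡ w≡)

    triangle-vertices : ∀ {σ u v w} → fdeg σ ≡ 3 → u ∈ σ → v ∈ σ → w ∈ σ →
      u ≢ v → u ≢ w → v ≢ w → ∀ {t} → t ∈ σ → t ≡ u ⊎ t ≡ v ⊎ t ≡ w
    triangle-vertices {σ} σ-triangle (i , refl) (j , refl) (k , refl) u≢v u≢w v≢w (l , refl) =
      Sum.map (cong (bd σ)) (Sum.map (cong (bd σ)) (cong (bd σ)))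
        (three-distinct-exhaust σ-triangle i j k l
          (u≢v ∘ cong (bd σ)) (u≢w ∘ cong (bd σ)) (v≢w ∘ cong (bd σ)))

    edge-at-corner : ∀ {σ x z} → Edge σ x z →
      ∃ λ i → cor x i ≡ σ × (z ≡ nb x i ⊎ z ≡ nb x (csuc i))
    edge-at-corner {σ} {x} x-z with cor-all σ x (edge-source x-z)
    ... | i , refl = i , refl , corner-neighbours (cor-bd x i) x-z

    faces-at-edge : ∀ {σ x z k} → nb x k ≡ z → Edge σ x z → σ ≡ cor x k ⊎ σ ≡ cor x (cpred k)
    faces-at-edge {x = x} k≡ x-z with edge-at-corner x-z
    ... | i , refl , inj₁ z≡ with nb-inj x (trans k≡ z≡)
    ...   | refl = inj₁ refl
    faces-at-edge {x = x} k≡ x-z | i , refl , inj₂ z≡ with nb-inj x (trans k≡ z≡)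
    ...   | refl = inj₂ (cong (cor x) (sym (cpred-csuc i)))

    edge-spoke : ∀ {σ x z} → Edge σ x z → ∃ λ k → nb x k ≡ z
    edge-spoke x-z with edge-at-corner x-z
    ... | i , _ , inj₁ z≡ = i , sym z≡
    ... | i , _ , inj₂ z≡ = csuc i , sym z≡

    edge-in-two-faces : ∀ {A B C x z} → Edge A x z → Edge B x z → Edge C x z →
      A ≡ B ⊎ A ≡ C ⊎ B ≡ C
    edge-in-two-faces A-xz B-xz C-xz with edge-spoke A-xz
    ... | k , k≡ =
      pigeonhole (faces-at-edge k≡ A-xz) (faces-at-edge k≡ B-xz) (faces-at-edge k≡ C-xz)

    opposite-sides : ∀ {Q σ₁ σ₂} → fdeg Q ≡ 4 → (∀ v → v ∈ σ₁ → v ∈ σ₂ → ¬ v ∈ Q) →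
      LowerAdj T Q σ₁ → LowerAdj T Q σ₂ → OppositeSides Q σ₁ σ₂
    opposite-sides {Q} {σ₁} {σ₂} Q-square disjoint Q~σ₁ Q~σ₂
      with boundary-edge Q~σ₁ | boundary-edge Q~σ₂
    ... | j , σ₁-edge | k , σ₂-edge = record
      { a = bd Q j ; b = bd Q (csuc j) ; c = bd Q k ; d = bd Q (csuc k)
      ; σ₁-ab = σ₁-edge
      ; σ₂-dc = edge-sym σ₂-edge
      ; Q-ab  = j , inj₁ (refl , refl)
      ; Q-ad  = csuc k , inj₂ (refl , cong (bd Q) k+2≡j)
      ; Q-dc  = k , inj₂ (refl , refl)
      ; b≢d   = j≢k ∘ csuc-injective ∘ bd-inj Q
      ; c≢a   = ≢-sym j≢k ∘ bd-inj Q
      }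
      where
      apart : ∀ {i i′} → bd Q i ∈ σ₁ → bd Q i′ ∈ σ₂ → i ≢ i′
      apart i∈σ₁ i∈σ₂ refl = disjoint _ i∈σ₁ i∈σ₂ (_ , refl)

      j≢k : j ≢ k
      j≢k = apart (edge-source σ₁-edge) (edge-source σ₂-edge)

      k+2≡j : csuc (csuc k) ≡ j
      k+2≡j = opposite-sides-of-4-cycle Q-square k j (≢-sym j≢k)
        (≢-sym (apart (edge-source σ₁-edge) (edge-target σ₂-edge)))
        (≢-sym (apart (edge-target σ₁-edge) (edge-source σ₂-edge)))

    module _ {x : V} (W : Wheel x)
             (P-large : 8 ≤ fdeg (face W 0F)) (Q-square : fdeg (face W 1F) ≡ 4) where
      open Wheel W hiding (face; spoke)

      private
        P Q S τ : F
        P = face W 0F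
        Q = face W 1F
        S = face W 2F
        τ = face W 3F

        x′ y z apex : V
        x′   = spoke W 0F
        y    = spoke W 1F
        z    = spoke W 2F
        apex = spoke W 3F

        triangle : ∀ j → 0F ≢ j → 1F ≢ j → fdeg (face W j) ≡ 3
        triangle j 0≢j 1≢j = ℕ.≤-antisym (ℕ.≤-pred (ℕ.≰⇒> j-not-large)) (fdeg≥3 (face W j))
          where
          j-not-large : ¬ 4 ≤ fdeg (face W j)
          j-not-large = no-large-triple (λ ()) 0≢j 1≢j P-large (ℕ.≤-reflexive (sym Q-square))

        S-triangle : fdeg S ≡ 3
        S-triangle = triangle 2F (λ ()) (λ ())

        τ-triangle : fdeg τ ≡ 3
        τ-triangle = triangle 3F (λ ()) (λ ())

        P≢Q : P ≢ Q
        P≢Q = large≢square P-large Q-square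

        τ-vertices : ∀ {t} → t ∈ τ → t ≡ x ⊎ t ≡ apex ⊎ t ≡ x′
        τ-vertices = triangle-vertices τ-triangle (corner-centre (corner 3F)) (corner-left (corner 3F))
          (corner-right (corner 3F)) (centre≢spoke 3F) (centre≢spoke 0F) (spoke≢ (λ ()))

        apex∉Q : ¬ apex ∈ Q
        apex∉Q apex∈Q = meet-two S Q (triangle≢square S-triangle Q-square) x z apex
          (centre≢spoke 2F) (spoke≢ (λ ())) (centre≢spoke 3F)
          (corner-centre (corner 2F)) (corner-centre (corner 1F))
          (corner-left (corner 2F)) (corner-right (corner 1F))
          (corner-right (corner 2F)) apex∈Q

        x′∉Q : ¬ x′ ∈ Q
        x′∉Q x′∈Q = meet-two P Q P≢Q x y x′
          (centre≢spoke 1F) (spoke≢ (λ ())) (centre≢spoke 0F)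
          (corner-centre (corner 0F)) (corner-centre (corner 1F))
          (corner-right (corner 0F)) (corner-left (corner 1F))
          (corner-left (corner 0F)) x′∈Q

        apex∉P : ¬ apex ∈ P
        apex∉P apex∈P = meet-two τ P (triangle≢large τ-triangle P-large) x apex x′
          (centre≢spoke 3F) (spoke≢ (λ ())) (centre≢spoke 0F)
          (corner-centre (corner 3F)) (corner-centre (corner 0F))
          (corner-left (corner 3F)) apex∈P
          (corner-right (corner 3F)) (corner-left (corner 0F))

        τ∩Q : ∀ u → u ∈ τ → u ∈ Q → u ≡ x
        τ∩Q u u∈τ u∈Q with τ-vertices u∈τ
        ... | inj₁ u≡x         = u≡x
        ... | inj₂ (inj₁ refl) = ⊥-elim (apex∉Q u∈Q)
        ... | inj₂ (inj₂ refl) = ⊥-elim (x′∉Q u∈Q)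

        τ-outside-P : ∀ v → (v ∈ τ × ¬ v ∈ P) ⇔ v ≡ apex
        τ-outside-P v = mk⇔ outside⇒apex (λ { refl → corner-left (corner 3F) , apex∉P })
          where
          outside⇒apex : v ∈ τ × ¬ v ∈ P → v ≡ apex
          outside⇒apex (v∈τ , v∉P) with τ-vertices v∈τ
          ... | inj₁ refl        = ⊥-elim (v∉P (corner-centre (corner 0F)))
          ... | inj₂ (inj₁ v≡)   = v≡
          ... | inj₂ (inj₂ refl) = ⊥-elim (v∉P (corner-left (corner 0F)))

      wheel-triangles : CornerTriangles x P Q z
      wheel-triangles = record
        { S = S ; τ = τ ; apex = apex
        ; S-triangle   = S-triangle
        ; τ-triangle   = τ-triangle
        ; S-xz         = corner-left-edge (corner 2F)
        ; apex∈S       = corner-right (corner 2F)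
        ; S-vertices   = triangle-vertices S-triangle (corner-centre (corner 2F)) (corner-left (corner 2F))
            (corner-right (corner 2F)) (centre≢spoke 2F) (centre≢spoke 3F) (spoke≢ (λ ()))
        ; apex≢x       = spoke≢centre 3F
        ; apex≢z       = spoke≢ (λ ())
        ; τ-σ-adjacent =
            (x , x′ , corner-right-edge (corner 3F) , corner-left-edge (corner 0F)) ,
            (x , y , corner-left-edge (corner 1F) , corner-right-edge (corner 0F)) ,
            (x , corner-centre (corner 3F) , corner-centre (corner 1F) , corner-centre (corner 0F) , τ∩Q)
        ; τ-outside-P  = τ-outside-P
        }

    module _ {x : V} (W : Wheel x) where
      open Wheel W hiding (face; spoke)

      align : ∀ {P Q y} → Edge P x y → Edge Q x y → P ≢ Q → Σ (Wheel x) λ W′ → Aligned W′ P Q y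
      align P-xy Q-xy P≢Q with covers (edge-source P-xy) | covers (edge-source Q-xy)
      ... | p , refl | q , refl with corner-neighbours (corner p) P-xy | corner-neighbours (corner q) Q-xy
      ... | inj₁ y≡ | inj₁ y≡′ =
        ⊥-elim (P≢Q (cong (face W) (spoke-injective (trans (sym y≡) y≡′))))
      ... | inj₂ y≡ | inj₂ y≡′ =
        ⊥-elim (P≢Q (cong (face W) (csuc-injective (spoke-injective (trans (sym y≡) y≡′)))))
      ... | inj₂ refl | inj₁ y≡ with spoke-injective y≡
      ...   | refl = rotate-to W p
      align P-xy Q-xy P≢Q | p , refl | q , refl | inj₁ refl | inj₂ y≡ with spoke-injective y≡
      ...   | refl = reflect-to W q

    shared-apex : ∀ {a d P₁ P₂ Q} → fdeg Q ≡ 4 → Edge Q a d →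
      (A : CornerTriangles a P₁ Q d) (D : CornerTriangles d P₂ Q a) →
      CornerTriangles.apex A ≡ CornerTriangles.apex D
    shared-apex {Q = Q} Q-square Q-ad A D =
      common-S⇒common-apex (edge-in-two-faces A.S-xz (edge-sym D.S-xz) Q-ad)
      where
      module A = CornerTriangles A
      module D = CornerTriangles D

      common-S⇒common-apex : A.S ≡ D.S ⊎ A.S ≡ Q ⊎ D.S ≡ Q → A.apex ≡ D.apex
      common-S⇒common-apex (inj₂ (inj₁ S≡Q)) = ⊥-elim (triangle≢square A.S-triangle Q-square S≡Q)
      common-S⇒common-apex (inj₂ (inj₂ S≡Q)) = ⊥-elim (triangle≢square D.S-triangle Q-square S≡Q)
      common-S⇒common-apex (inj₁ S≡S) with A.S-vertices (subst (D.apex ∈_) (sym S≡S) D.apex∈S)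
      ... | inj₁ apex≡a        = ⊥-elim (D.apex≢z apex≡a)
      ... | inj₂ (inj₁ apex≡d) = ⊥-elim (D.apex≢x apex≡d)
      ... | inj₂ (inj₂ apex≡)  = sym apex≡

    module NonNegative (4-regular : FourRegular T) (Φ≥0 : NonNegCurvature T) where

      wheel : ∀ x → Wheel x
      wheel x = star (vdeg x) (4-regular x) (nb x) (cor x) (nb-inj x) (nb-loop x) (cor-bd x)
        (cor-all _ x) (Φ≥0 x)
        where
        -- Abstracting over vdeg x lets 4-regularity be used by matching on refl.
        star : ∀ n → n ≡ 4 → (spoke : Fin n → V) (face : Fin n → F) →
          (∀ {i j} → spoke i ≡ spoke j → i ≡ j) → (∀ i → spoke i ≢ x) →
          (∀ i → Corner (face i) x (spoke i) (spoke (csuc i))) →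
          (∀ {σ} → x ∈ σ → ∃ λ i → face i ≡ σ) →
          0ℚᵘ ≤q vertexCurvature n (fdeg ∘ face) → Wheel x
        star .4 refl spoke face spoke-injective spoke≢centre corner covers Φ≥0 = record
          { face = face ; spoke = spoke ; corner = corner ; covers = covers
          ; spoke-injective = spoke-injective ; spoke≢centre = spoke≢centre
          ; no-large-triple = λ p≢q p≢j q≢j 8≤p 4≤q 4≤j →
              large-corners-curvature<0 (fdeg ∘ face) (fdeg≥3 ∘ face) p≢q p≢j q≢j 8≤p 4≤q 4≤j Φ≥0
          }

      no-common-vertex : ∀ {σ₁ σ₂ Q} → σ₁ ≢ σ₂ → 8 ≤ fdeg σ₁ → 8 ≤ fdeg σ₂ → fdeg Q ≡ 4 →
        ∀ v → v ∈ σ₁ → v ∈ σ₂ → ¬ v ∈ Q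
      no-common-vertex σ₁≢σ₂ σ₁-large σ₂-large Q-square v v∈σ₁ v∈σ₂ v∈Q
        with Wheel.covers (wheel v) v∈σ₁ | Wheel.covers (wheel v) v∈σ₂ | Wheel.covers (wheel v) v∈Q
      ... | i , refl | j , refl | k , refl =
        Wheel.no-large-triple (wheel v) (apart (large≢square σ₁-large Q-square)) (apart σ₁≢σ₂)
          (apart (≢-sym (large≢square σ₂-large Q-square)))
          σ₁-large (ℕ.≤-reflexive (sym Q-square)) (ℕ.≤-trans (ℕ.m≤m+n 4 4) σ₂-large)
        where
        apart : ∀ {i j} → face (wheel v) i ≢ face (wheel v) j → i ≢ j
        apart face≢ = face≢ ∘ cong (face (wheel v))

      corner-triangles : ∀ {x P Q y z} → 8 ≤ fdeg P → fdeg Q ≡ 4 →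
        Edge P x y → Edge Q x y → Edge Q x z → y ≢ z → CornerTriangles x P Q z
      corner-triangles {x} P-large Q-square P-xy Q-xy Q-xz y≢z
        with align (wheel x) P-xy Q-xy (large≢square P-large Q-square)
      ... | W , refl , refl , refl with corner-neighbours (Wheel.corner W 1F) Q-xz
      ...   | inj₁ z≡y  = ⊥-elim (y≢z (sym z≡y))
      ...   | inj₂ refl = wheel-triangles W P-large Q-square

lemma4p4 : (T : PreTess) → IsInfinitePlanarTessellation T → FourRegular T → NonNegCurvature T →
    (σ₁ σ₂ : PreTess.F T) → σ₁ ≢ σ₂ → 8 ≤ PreTess.fdeg T σ₁ → 8 ≤ PreTess.fdeg T σ₂ →
    (Q : PreTess.F T) → PreTess.fdeg T Q ≡ 4 → LowerAdj T Q σ₁ → LowerAdj T Q σ₂ →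
    ∃ λ τ → ∃ λ ω → PreTess.fdeg T τ ≡ 3 × PreTess.fdeg T ω ≡ 3 ×
    SigmaAdj T σ₁ τ Q × SigmaAdj T σ₂ ω Q ×
    (∀ v → ((_∈∂_ T v τ × ¬ _∈∂_ T v σ₁) ⇔ (_∈∂_ T v ω × ¬ _∈∂_ T v σ₂)))
lemma4p4 T ax 4-regular Φ≥0 σ₁ σ₂ σ₁≢σ₂ σ₁-large σ₂-large Q Q-square Q~σ₁ Q~σ₂ =
  A.τ , D.τ , A.τ-triangle , D.τ-triangle , A.τ-σ-adjacent , D.τ-σ-adjacent ,
  λ v → ⇔-trans (A.τ-outside-P v) (⇔-trans (≡-apex v) (⇔-sym (D.τ-outside-P v)))
  where
  open Tessellation T
  open Planar ax
  open NonNegative 4-regular Φ≥0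
  open OppositeSides (opposite-sides Q-square
    (no-common-vertex σ₁≢σ₂ σ₁-large σ₂-large Q-square) Q~σ₁ Q~σ₂)

  A : CornerTriangles a σ₁ Q d
  A = corner-triangles σ₁-large Q-square σ₁-ab Q-ab Q-ad b≢d

  D : CornerTriangles d σ₂ Q a
  D = corner-triangles σ₂-large Q-square σ₂-dc Q-dc (edge-sym Q-ad) c≢a

  module A = CornerTriangles A
  module D = CornerTriangles D

  apex≡ : A.apex ≡ D.apex
  apex≡ = shared-apex Q-square Q-ad A D

  ≡-apex : ∀ v → v ≡ A.apex ⇔ v ≡ D.apex
  ≡-apex v = mk⇔ (λ v≡ → trans v≡ apex≡) (λ v≡ → trans v≡ (sym apex≡))
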